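{- Let $(R,v)$ be a discrete valuation domain. Let $f=a_0+a_1x+\cdots+a_nx^n\in R[x]$ be a primitive polynomial such that there exist indices $j$ and $\ell$ with $1\leq \ell+1\leq j\leq n$ for which the following hold: (i) $v(a_j)=0$; (ii) $\frac{v(a_\ell)}{j-\ell}<\frac{v(a_i)}{j-i}$ for each $i=0,1,\ldots,j-1$ with $i\neq \ell$; (iii) $\gcd(v(a_\ell),\,j-\ell)=1$. Then in any factorization $f(x)=f_1(x)f_2(x)$ of $f$ in $R[x]$, at least one of $f_1,f_2$ has degree $\geq j-\ell$. In particular, if $j=n$ and $\ell=0$, then $f$ is irreducible in $R[x]$.
   Context: A discrete valuation domain $(R,v)$ is an integral domain $R$ which is the valuation ring of a discrete valuation $v$ (with values in $\mathbb{Z}\cup\{\infty\}$, $v(0)=\infty$) on its field of fractions; thus $v\geq 0$ on $R$. A polynomial over $R$ is primitive if its coefficients are not all divisible by a uniformizer, i.e. $\min_i v(a_i)=0$. -}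

module Defs where

open import Level using (Level; _⊔_; suc)
open import Algebra.Bundles using (CommutativeRing)
open import Data.Nat as ℕ using (ℕ; _∸_)
import Data.Nat.GCD as G
open import Data.Product using (Σ; ∃; _×_; _,_)
open import Data.Sum using (_⊎_)
open import Data.Unit using (⊤)
open import Relation.Nullary using (¬_)
open import Relation.Binary.PropositionalEquality using (_≡_)

-- ℕ ∪ {∞}: value set of a discrete valuation that is ≥ 0 on R
data ℕ∞ : Set where
  fin : ℕ → ℕ∞
  ∞   : ℕ∞

infixl 6 _+∞_
_+∞_ : ℕ∞ → ℕ∞ → ℕ∞
fin m +∞ fin n = fin (m ℕ.+ n)
fin _ +∞ ∞     = ∞
∞     +∞ _     = ∞

infix 4 _≤∞_
data _≤∞_ : ℕ∞ → ℕ∞ → Set where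
  fin≤fin : ∀ {m n} → m ℕ.≤ n → fin m ≤∞ fin n
  _≤∞∞    : ∀ x → x ≤∞ ∞

min∞ : ℕ∞ → ℕ∞ → ℕ∞
min∞ (fin m) (fin n) = fin (m ℕ.⊓ n)
min∞ (fin m) ∞       = fin m
min∞ ∞       y       = y

-- A discrete valuation domain (R , v): an integral domain R together with a
-- normalised discrete valuation v (values in ℤ ∪ {∞}, surjective onto ℤ)
-- on Frac R whose valuation ring is exactly R.  Since v ≥ 0 on R, v
-- restricted to R takes values in ℕ ∪ {∞}.  "R is the valuation ring of v"
-- is expressed inside R by: v x ≤ v y ⇒ x ∣ y  (i.e. y/x ∈ Frac R with
-- v(y/x) ≥ 0 lies in R).
record DVD (c ℓ : Level) : Set (suc (c ⊔ ℓ)) where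
  field
    commRing : CommutativeRing c ℓ
  open CommutativeRing commRing public
  field
    nontrivial   : ¬ (1# ≈ 0#)
    noZeroDivisors : ∀ x y → x * y ≈ 0# → x ≈ 0# ⊎ y ≈ 0#
    v            : Carrier → ℕ∞
    v-cong       : ∀ {x y} → x ≈ y → v x ≡ v y
    v-zero       : ∀ x → v x ≡ ∞ → x ≈ 0#
    v-0#         : v 0# ≡ ∞
    v-mult       : ∀ x y → v (x * y) ≡ v x +∞ v y
    v-add        : ∀ x y → min∞ (v x) (v y) ≤∞ v (x + y)
    -- normalised (surjective onto ℤ): a uniformizer exists
    uniformizer  : ∃ λ π → v π ≡ fin 1
    valuationRing : ∀ x y → v x ≤∞ v y → ∃ λ z → y ≈ x * z

module Poly {c ℓ} (D : DVD c ℓ) where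
  open DVD D

  -- polynomials over R as coefficient sequences ℕ → R
  -- (only finitely supported ones are considered as elements of R[x])
  Poly : Set c
  Poly = ℕ → Carrier

  FinSupp : Poly → Set (ℓ)
  FinSupp p = ∃ λ N → ∀ k → N ℕ.< k → p k ≈ 0#

  HasDegree : Poly → ℕ → Set ℓ
  HasDegree p d = ¬ (p d ≈ 0#) × (∀ k → d ℕ.< k → p k ≈ 0#)

  sumTo : (ℕ → Carrier) → ℕ → Carrier
  sumTo g ℕ.zero    = g ℕ.zero
  sumTo g (ℕ.suc k) = sumTo g k + g (ℕ.suc k)

  _⊛_ : Poly → Poly → Poly
  (p ⊛ q) k = sumTo (λ i → p i * q (k ∸ i)) k

  _≋_ : Poly → Poly → Set ℓ
  p ≋ q = ∀ k → p k ≈ q k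

  const : Carrier → Poly
  const a ℕ.zero      = a
  const a (ℕ.suc _) = 0#

  IsUnitPoly : Poly → Set (c ⊔ ℓ)
  IsUnitPoly p = ∃ λ q → FinSupp q × (p ⊛ q) ≋ const 1#

  Irreducible : Poly → Set (c ⊔ ℓ)
  Irreducible f = ¬ IsUnitPoly f ×
    (∀ f₁ f₂ → FinSupp f₁ → FinSupp f₂ → f ≋ (f₁ ⊛ f₂) →
       IsUnitPoly f₁ ⊎ IsUnitPoly f₂)

  Primitive : Poly → ℕ → Set
  Primitive a n = ∃ λ i → i ℕ.≤ n × v (a i) ≡ fin 0

  -- hypothesis (ii) for i:  v(a_ℓ)/(j-ℓ) < v(a_i)/(j-i), with v(a_ℓ) = m,
  -- written by cross-multiplication (both denominators positive);
  -- if v(a_i) = ∞ the inequality holds.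
  SlopeLess : ℕ → ℕ → ℕ → ℕ → ℕ∞ → Set
  SlopeLess m j l i (fin t) = m ℕ.* (j ∸ i) ℕ.< t ℕ.* (j ∸ l)
  SlopeLess m j l i ∞       = ⊤

-- Weight a monomial c·xᵏ by (j − ℓ)·v(c) + m·k, where m = v(a_ℓ). For a nonzero polynomial the
-- indices of its monomials of minimal weight span a segment [lo, hi] (a `Face`: the edge of slope
-- −m/(j − ℓ) of the Newton polygon). As in Gauss's lemma, the face of a
-- product is the sum of the faces of the factors, since at lo₁ + lo₂ and hi₁ + hi₂ a single term of
-- the convolution is strictly minimal. By (i) and (ii) the minimum for f is m·j, attained at ℓ and j,
-- so the faces of f₁ and f₂ have total width at least j − ℓ. On a face
-- (j − ℓ)·(v(c_lo) − v(c_hi)) = m·(hi − lo), so by (iii) each width is a multiple of j − ℓ; hence one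
-- factor has a face, and so a degree, of width at least j − ℓ. When j = n and ℓ = 0 the other factor
-- has degree 0, and its constant term is a unit because v(a_n) = 0.

module Submission where

open import Defs
open import Level using (Level; _⊔_)
open import Data.Nat as ℕ using (ℕ; zero; suc; _∸_; _≤_; _<_; z≤n; s≤s; _≟_; _≤?_; _<?_)
open import Data.Nat.Properties
  using (anyUpTo?; m≤n⇒m<n∨m≡n; ≰⇒>; ≮⇒≥; ≤-refl; ≤-trans; ≤-antisym; ≤-pred; ≤∧≢⇒<; <⇒≢; m≤n⇒m≤1+n;
         m≤m+n; m+n∸m≡n; <⇒≤; m+n≡0⇒m≡0; m∸n≤m)
open import Data.Nat.Induction using (<-rec)
open import Data.Nat.Divisibility using (_∣_; ∣m+n∣m⇒∣n; m∣m*n; ∣⇒≤)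
open import Data.Nat.Coprimality using (Coprime; coprime-divisor; gcd≡1⇒coprime)
import Data.Nat.Coprimality as Coprime
open import Data.Nat.GCD using (gcd)
open import Data.Nat.Tactic.RingSolver using (solve-∀)
open import Data.Empty using (⊥-elim)
open import Function using (_∘_; case_of_)
open import Data.Product using (∃; ∃-syntax; _×_; _,_; proj₁; proj₂)
open import Data.Sum as Sum using (_⊎_; inj₁; inj₂)
open import Relation.Nullary using (¬_; Dec; yes; no)
open import Relation.Unary using (Pred; Decidable)
open import Relation.Binary.Definitions using (tri<; tri≈; tri>)
open import Relation.Binary.PropositionalEquality
  using (_≡_; _≢_; refl; sym; trans; cong; cong₂; subst; ≢-sym; module ≡-Reasoning)

module ℕ∞-Properties where
  open import Data.Nat using (_+_)
  open import Data.Nat.Properties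

  ≤∞-refl : ∀ {x} → x ≤∞ x
  ≤∞-refl {fin n} = fin≤fin ≤-refl
  ≤∞-refl {∞}     = ∞ ≤∞∞

  ≤∞-reflexive : ∀ {x y} → x ≡ y → x ≤∞ y
  ≤∞-reflexive refl = ≤∞-refl

  ≤∞-trans : ∀ {x y z} → x ≤∞ y → y ≤∞ z → x ≤∞ z
  ≤∞-trans (fin≤fin p) (fin≤fin q) = fin≤fin (≤-trans p q)
  ≤∞-trans {x} _ (_ ≤∞∞)          = x ≤∞∞

  0≤∞ : ∀ x → fin 0 ≤∞ x
  0≤∞ (fin n) = fin≤fin z≤n
  0≤∞ ∞       = fin 0 ≤∞∞

  ≤∞-≡∞ : ∀ {z x} → x ≡ ∞ → z ≤∞ x
  ≤∞-≡∞ refl = _ ≤∞∞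

  ≤∞-weaken : ∀ {w x} → fin (suc w) ≤∞ x → fin w ≤∞ x
  ≤∞-weaken = ≤∞-trans (fin≤fin (n≤1+n _))

  ≤∞-min : ∀ {x y z} → z ≤∞ x → z ≤∞ y → z ≤∞ min∞ x y
  ≤∞-min (fin≤fin p) (fin≤fin q) = fin≤fin (⊓-glb p q)
  ≤∞-min (fin≤fin p) (_ ≤∞∞)     = fin≤fin p
  ≤∞-min (_ ≤∞∞)     q           = q

  fin-injective : ∀ {m n} → fin m ≡ fin n → m ≡ n
  fin-injective refl = refl

  fin≤∞⁻ : ∀ {m n} → fin m ≤∞ fin n → m ≤ n
  fin≤∞⁻ (fin≤fin p) = p

  ≤∞-irrefl : ∀ {w x} → x ≡ fin w → ¬ fin (suc w) ≤∞ x
  ≤∞-irrefl refl (fin≤fin p) = <-irrefl refl p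

  ≤∞∧≢⇒< : ∀ {w x} → fin w ≤∞ x → x ≢ fin w → fin (suc w) ≤∞ x
  ≤∞∧≢⇒< (fin≤fin p) x≢w = fin≤fin (≤∧≢⇒< p (λ w≡n → x≢w (cong fin (sym w≡n))))
  ≤∞∧≢⇒< (_ ≤∞∞)     _   = _ ≤∞∞

  ≡fin? : ∀ x w → Dec (x ≡ fin w)
  ≡fin? (fin n) w with n ≟ w
  ... | yes refl = yes refl
  ... | no  n≢w  = no (λ eq → n≢w (fin-injective eq))
  ≡fin? ∞       w = no λ ()

  ≤∞∧≮⇒≡ : ∀ {w x} → fin w ≤∞ x → ¬ fin (suc w) ≤∞ x → x ≡ fin w
  ≤∞∧≮⇒≡ {w} {x} w≤x w≮x with ≡fin? x w
  ... | yes x≡w = x≡w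
  ... | no  x≢w = ⊥-elim (w≮x (≤∞∧≢⇒< w≤x x≢w))

  x≤∞y+∞x : ∀ x y → x ≤∞ y +∞ x
  x≤∞y+∞x (fin m) (fin n) = fin≤fin (m≤n+m m n)
  x≤∞y+∞x ∞       (fin n) = ∞ ≤∞∞
  x≤∞y+∞x x       ∞       = x ≤∞∞

  +∞-mono-≤∞ : ∀ {x x′ y y′} → x ≤∞ x′ → y ≤∞ y′ → x +∞ y ≤∞ x′ +∞ y′
  +∞-mono-≤∞ (fin≤fin p) (fin≤fin q) = fin≤fin (+-mono-≤ p q)
  +∞-mono-≤∞ (fin≤fin _) (_ ≤∞∞)     = _ ≤∞∞
  +∞-mono-≤∞ {y = y} (_ ≤∞∞) _       = (_ +∞ y) ≤∞∞

  +∞-strict : ∀ {w₁ w₂ x y} → fin w₁ ≤∞ x → fin w₂ ≤∞ y →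
              fin (suc w₁) ≤∞ x ⊎ fin (suc w₂) ≤∞ y → fin (suc (w₁ + w₂)) ≤∞ x +∞ y
  +∞-strict _ w₂≤y (inj₁ w₁<x) = +∞-mono-≤∞ w₁<x w₂≤y
  +∞-strict {w₁} {w₂} {x} {y} w₁≤x _ (inj₂ w₂<y) =
    subst (λ s → fin s ≤∞ x +∞ y) (+-suc w₁ w₂) (+∞-mono-≤∞ w₁≤x w₂<y)

  +∞≡0 : ∀ x y → x +∞ y ≡ fin 0 → x ≡ fin 0 × y ≡ fin 0
  +∞≡0 (fin m) (fin n) eq = cong fin (m+n≡0⇒m≡0 m (fin-injective eq)) , cong fin (m+n≡0⇒n≡0 m (fin-injective eq))

open ℕ∞-Properties

module IndexArithmetic where
  open import Data.Nat using (_+_)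
  open import Data.Nat.Properties

  i+h<k⇒h<k∸i : ∀ {i h k} → i + h < k → h < k ∸ i
  i+h<k⇒h<k∸i {i} {h} {k} lt = m+n≤o⇒m≤o∸n (suc h) (subst (λ x → suc x ≤ k) (+-comm i h) lt)

  k<i+l⇒k∸i<l : ∀ {i k l} → i ≤ k → k < i + l → k ∸ i < l
  k<i+l⇒k∸i<l {i} {k} {l} i≤k lt = subst (k ∸ i <_) (m+n∸m≡n i l) (∸-monoˡ-< lt i≤k)

  past-top : ∀ {h₁ h₂ k i} → h₁ + h₂ ≤ k → i ≢ h₁ ⊎ h₁ + h₂ < k → h₁ < i ⊎ h₂ < k ∸ i
  past-top {h₁} {h₂} {k} {i} top≤k i≢h₁∨top<k with <-cmp i h₁ | i≢h₁∨top<k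
  ... | tri> _ _ h₁<i | _          = inj₁ h₁<i
  ... | tri< i<h₁ _ _ | _          = inj₂ (i+h<k⇒h<k∸i (<-≤-trans (+-monoˡ-< h₂ i<h₁) top≤k))
  ... | tri≈ _ refl _ | inj₁ i≢i   = ⊥-elim (i≢i refl)
  ... | tri≈ _ refl _ | inj₂ top<k = inj₂ (i+h<k⇒h<k∸i top<k)

  past-bottom : ∀ {l₁ l₂ k i} → i ≤ k → k ≤ l₁ + l₂ → i ≢ l₁ ⊎ k < l₁ + l₂ → i < l₁ ⊎ k ∸ i < l₂
  past-bottom {l₁} {l₂} {k} {i} i≤k k≤bottom i≢l₁∨k<bottom with <-cmp i l₁ | i≢l₁∨k<bottom
  ... | tri< i<l₁ _ _ | _             = inj₁ i<l₁
  ... | tri> _ _ l₁<i | _             = inj₂ (k<i+l⇒k∸i<l i≤k (≤-<-trans k≤bottom (+-monoˡ-< l₂ l₁<i)))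
  ... | tri≈ _ refl _ | inj₁ i≢i      = ⊥-elim (i≢i refl)
  ... | tri≈ _ refl _ | inj₂ k<bottom = inj₂ (k<i+l⇒k∸i<l i≤k k<bottom)

  width-bound : ∀ {l j lo₁ hi₁ lo₂ hi₂} → lo₁ ≤ hi₁ → lo₂ ≤ hi₂ → lo₁ + lo₂ ≤ l → j ≤ hi₁ + hi₂ →
                j ∸ l ≤ (hi₁ ∸ lo₁) + (hi₂ ∸ lo₂)
  width-bound {l} {j} {lo₁} {hi₁} {lo₂} {hi₂} lo₁≤hi₁ lo₂≤hi₂ bottom≤l j≤top = m≤n+o⇒m∸n≤o j l (begin
    j                                  ≤⟨ j≤top ⟩
    hi₁ + hi₂                          ≡⟨ sym (cong₂ _+_ (m+[n∸m]≡n lo₁≤hi₁) (m+[n∸m]≡n lo₂≤hi₂)) ⟩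
    (lo₁ + d₁) + (lo₂ + d₂)            ≡⟨ interchange lo₁ d₁ lo₂ d₂ ⟩
    (lo₁ + lo₂) + (d₁ + d₂)            ≤⟨ +-monoˡ-≤ (d₁ + d₂) bottom≤l ⟩
    l + (d₁ + d₂)                      ∎)
    where
    open ≤-Reasoning
    d₁ d₂ : ℕ
    d₁ = hi₁ ∸ lo₁
    d₂ = hi₂ ∸ lo₂
    interchange : ∀ a b c d → (a + b) + (c + d) ≡ (a + c) + (b + d)
    interchange = solve-∀

  ≤-+-∣ : ∀ {p x y} → p ≤ x + y → p ∣ x → p ≤ x ⊎ p ≤ y
  ≤-+-∣ {x = zero}  p≤y _   = inj₂ p≤y
  ≤-+-∣ {x = suc x} _   p∣x = inj₁ (∣⇒≤ p∣x)

  m+n≤m⇒n≡0 : ∀ m {n} → m + n ≤ m → n ≡ 0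
  m+n≤m⇒n≡0 m {n} le = n≤0⇒n≡0 (+-cancelˡ-≤ m n 0 (subst (m + n ≤_) (sym (+-identityʳ m)) le))

  m+n≤n⇒m≡0 : ∀ {m} n → m + n ≤ n → m ≡ 0
  m+n≤n⇒m≡0 {m} n le = m+n≤m⇒n≡0 n (subst (_≤ n) (+-comm m n) le)

open IndexArithmetic

module _ {p} {P : Pred ℕ p} (P? : Decidable P) where
  private
    Least Greatest : Set p
    Least    = ∃[ i ] P i × (∀ {j} → j < i → ¬ P j)
    Greatest = ∃[ i ] P i × (∀ {j} → i < j → ¬ P j)

    none-from : ∀ {n} → ¬ P n → (∀ {j} → n < j → ¬ P j) → ∀ {j} → n ≤ j → ¬ P j
    none-from ¬Pn none-above n≤j with m≤n⇒m<n∨m≡n n≤j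
    ... | inj₁ n<j  = none-above n<j
    ... | inj₂ refl = ¬Pn

  least-witness : ∀ {k} → P k → Least
  least-witness {k} = <-rec (λ k → P k → Least) step k
    where
    step : ∀ k → (∀ {j} → j < k → P j → Least) → P k → Least
    step k rec Pk with anyUpTo? P? k
    ... | yes (j , j<k , Pj) = rec j<k Pj
    ... | no  none           = k , Pk , λ j<k Pj → none (_ , j<k , Pj)

  greatest-witness : ∀ N → (∀ {j} → N < j → ¬ P j) → ∀ {k} → P k → Greatest
  greatest-witness N none-above Pk with P? N
  ... | yes PN = N , PN , none-above
  greatest-witness zero    none-above Pk | no ¬P0 = ⊥-elim (none-from ¬P0 none-above z≤n Pk)
  greatest-witness (suc N) none-above Pk | no ¬PN = greatest-witness N (none-from ¬PN none-above) Pk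

record Face (ω : ℕ → ℕ∞) (w lo hi : ℕ) : Set where
  field
    at-lo   : ω lo ≡ fin w
    at-hi   : ω hi ≡ fin w
    minimal : ∀ i → fin w ≤∞ ω i
    below   : ∀ {i} → i < lo → fin (suc w) ≤∞ ω i
    above   : ∀ {i} → hi < i → fin (suc w) ≤∞ ω i

  lo≤hi : lo ≤ hi
  lo≤hi with lo ≤? hi
  ... | yes lo≤hi = lo≤hi
  ... | no  lo≰hi = ⊥-elim (≤∞-irrefl at-hi (below (≰⇒> lo≰hi)))

  within : ∀ {c x} → ω x ≡ fin c → (∀ i → fin c ≤∞ ω i) → lo ≤ x × x ≤ hi
  within {c} {x} ωx c-minimal = ≮⇒≥ x≮lo , ≮⇒≥ hi≮x
    where
    c<w+1 : fin (suc c) ≤∞ fin (suc w)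
    c<w+1 = fin≤fin (s≤s (fin≤∞⁻ (subst (fin c ≤∞_) at-lo (c-minimal lo))))
    x≮lo : ¬ x < lo
    x≮lo x<lo = ≤∞-irrefl ωx (≤∞-trans c<w+1 (below x<lo))
    hi≮x : ¬ hi < x
    hi≮x hi<x = ≤∞-irrefl ωx (≤∞-trans c<w+1 (above hi<x))

module _ {ω : ℕ → ℕ∞} {N : ℕ} (beyond : ∀ {i} → N < i → ω i ≡ ∞) where
  private
    finite⇒≤ : ∀ {i s} → ω i ≡ fin s → ¬ N < i
    finite⇒≤ ωi N<i with trans (sym ωi) (beyond N<i)
    ... | ()

    IsValue : Pred ℕ _
    IsValue w = ∃[ i ] i < suc N × ω i ≡ fin w

    value? : Decidable IsValue
    value? w = anyUpTo? (λ i → ≡fin? (ω i) w) (suc N)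

    value-at : ∀ w → Decidable (λ i → ω i ≡ fin w)
    value-at w i = ≡fin? (ω i) w

    face-of-minimum : ∀ {w i} → ω i ≡ fin w → (∀ {s} → s < w → ¬ IsValue s) →
                      ∃[ lo ] ∃[ hi ] Face ω w lo hi
    face-of-minimum {w} ωi w-least
      with least-witness (value-at w) ωi | greatest-witness (value-at w) N (λ N<j ωj → finite⇒≤ ωj N<j) ωi
    ... | lo , ωlo , none-below | hi , ωhi , none-above = lo , hi , record
      { at-lo   = ωlo
      ; at-hi   = ωhi
      ; minimal = minimal
      ; below   = λ i<lo → ≤∞∧≢⇒< (minimal _) (none-below i<lo)
      ; above   = λ hi<i → ≤∞∧≢⇒< (minimal _) (none-above hi<i)
      }
      where
      minimal : ∀ i → fin w ≤∞ ω i
      minimal i with ω i in ωi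
      ... | fin s = fin≤fin (≮⇒≥ λ s<w → w-least s<w (i , s≤s (≮⇒≥ (finite⇒≤ ωi)) , ωi))
      ... | ∞     = _ ≤∞∞

  face : ∀ {i₀ t} → ω i₀ ≡ fin t → ∃[ w ] ∃[ lo ] ∃[ hi ] Face ω w lo hi
  face ωi₀ with least-witness value? (_ , s≤s (≮⇒≥ (finite⇒≤ ωi₀)) , ωi₀)
  ... | w , (_ , _ , ωi) , w-least = w , face-of-minimum ωi w-least

module Weight (P m : ℕ) where
  open import Data.Nat using (_+_; _*_)
  open import Data.Nat.Properties

  weigh : ℕ → ℕ∞ → ℕ∞
  weigh k (fin s) = fin (P * s + m * k)
  weigh k ∞       = ∞

  weigh-mono : ∀ {k x y} → x ≤∞ y → weigh k x ≤∞ weigh k y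
  weigh-mono {k} (fin≤fin s≤t) = fin≤fin (+-monoˡ-≤ (m * k) (*-monoʳ-≤ P s≤t))
  weigh-mono     (_ ≤∞∞)       = _ ≤∞∞

  weigh-min : ∀ k x y → weigh k (min∞ x y) ≡ min∞ (weigh k x) (weigh k y)
  weigh-min k (fin s) (fin t) =
    cong fin (mono-≤-distrib-⊓ (λ s≤t → +-monoˡ-≤ (m * k) (*-monoʳ-≤ P s≤t)) s t)
  weigh-min k (fin s) ∞       = refl
  weigh-min k ∞       y       = refl

  weigh-+∞ : ∀ {i k} x y → i ≤ k → weigh k (x +∞ y) ≡ weigh i x +∞ weigh (k ∸ i) y
  weigh-+∞ {i} x y i≤k = subst (λ k → weigh k (x +∞ y) ≡ weigh i x +∞ weigh (k ∸ i) y)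
                              (m+[n∸m]≡n i≤k) (split x y (_ ∸ i))
    where
    distribute : ∀ P m s t i d → P * (s + t) + m * (i + d) ≡ (P * s + m * i) + (P * t + m * d)
    distribute = solve-∀
    split : ∀ x y d → weigh (i + d) (x +∞ y) ≡ weigh i x +∞ weigh (i + d ∸ i) y
    split x y d rewrite m+n∸m≡n i d with x | y
    ... | fin s | fin t = cong fin (distribute P m s t i d)
    ... | fin _ | ∞     = refl
    ... | ∞     | _     = refl

  weigh≡fin : ∀ {k x w} → weigh k x ≡ fin w → ∃[ s ] x ≡ fin s × P * s + m * k ≡ w
  weigh≡fin {x = fin s} refl = s , refl , refl

  face-width-divisible : ∀ {x : ℕ → ℕ∞} {w lo hi} → Coprime P m →
                         Face (λ i → weigh i (x i)) w lo hi → P ∣ hi ∸ lo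
  face-width-divisible {x} {w} {lo} {hi} coprime F
    with weigh≡fin {lo} {x lo} (Face.at-lo F) | weigh≡fin {hi} {x hi} (Face.at-hi F)
  ... | s , _ , ωlo | t , _ , ωhi =
    coprime-divisor coprime (∣m+n∣m⇒∣n (subst (P ∣_) shifted (m∣m*n s)) (m∣m*n t))
    where
    regroup : ∀ a m d l → a + m * (d + l) ≡ (a + m * d) + m * l
    regroup = solve-∀
    shifted : P * s ≡ P * t + m * (hi ∸ lo)
    shifted = +-cancelʳ-≡ (m * lo) _ _ (begin
      P * s + m * lo                 ≡⟨ trans ωlo (sym ωhi) ⟩
      P * t + m * hi                 ≡⟨ cong (λ h → P * t + m * h) (sym (m∸n+n≡m (Face.lo≤hi F))) ⟩
      P * t + m * (hi ∸ lo + lo)     ≡⟨ regroup (P * t) m (hi ∸ lo) lo ⟩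
      P * t + m * (hi ∸ lo) + m * lo ∎)
      where open ≡-Reasoning

module _ (m j l : ℕ) where
  open import Data.Nat using (_+_; _*_)
  open import Data.Nat.Properties
  open Weight (j ∸ l) m

  private
    split-at : ∀ {i} → i ≤ j → m * j ≡ m * (j ∸ i) + m * i
    split-at {i} i≤j = trans (cong (m *_) (sym (m∸n+n≡m i≤j))) (*-distribˡ-+ m (j ∸ i) i)

  weigh-vertexˡ : l ≤ j → weigh l (fin m) ≡ fin (m * j)
  weigh-vertexˡ l≤j = cong fin (sym (trans (split-at l≤j) (cong (_+ m * l) (*-comm m (j ∸ l)))))

  weigh-vertexʳ : weigh j (fin 0) ≡ fin (m * j)
  weigh-vertexʳ = cong (λ x → fin (x + m * j)) (*-zeroʳ (j ∸ l))

  weigh-slope : ∀ {i} t → i ≤ j → m * (j ∸ i) < t * (j ∸ l) → fin (m * j) ≤∞ weigh i (fin t)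
  weigh-slope {i} t i≤j slope = fin≤fin (begin
    m * j               ≡⟨ split-at i≤j ⟩
    m * (j ∸ i) + m * i ≤⟨ +-monoˡ-≤ (m * i) (<⇒≤ slope) ⟩
    t * (j ∸ l) + m * i ≡⟨ cong (_+ m * i) (*-comm t (j ∸ l)) ⟩
    (j ∸ l) * t + m * i ∎)
    where open ≤-Reasoning

  weigh-beyond : ∀ {i} x → j ≤ i → fin (m * j) ≤∞ weigh i x
  weigh-beyond {i} (fin t) j≤i = fin≤fin (≤-trans (*-monoʳ-≤ m j≤i) (m≤n+m (m * i) ((j ∸ l) * t)))
  weigh-beyond ∞       _   = _ ≤∞∞

module Valuation {c ℓ} (D : DVD c ℓ) where
  open DVD D renaming (refl to ≈-refl; sym to ≈-sym; trans to ≈-trans) hiding (zero)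
  open Poly D
  open import Algebra.Properties.Ring ring using (-1*x≈-x)
  open import Algebra.Properties.Group +-group using (//-rightDividesʳ)

  ≈0⇒v≡∞ : ∀ {x} → x ≈ 0# → v x ≡ ∞
  ≈0⇒v≡∞ x≈0 = trans (v-cong x≈0) v-0#

  v≡fin⇒≉0 : ∀ {x s} → v x ≡ fin s → ¬ x ≈ 0#
  v≡fin⇒≉0 vx x≈0 with trans (sym vx) (≈0⇒v≡∞ x≈0)
  ... | ()

  ≉0⇒v≡fin : ∀ {x} → ¬ x ≈ 0# → ∃[ s ] v x ≡ fin s
  ≉0⇒v≡fin {x} x≉0 with v x in vx
  ... | fin s = s , refl
  ... | ∞     = ⊥-elim (x≉0 (v-zero x vx))

  ≈0? : ∀ x → Dec (x ≈ 0#)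
  ≈0? x with v x in vx
  ... | fin s = no (v≡fin⇒≉0 vx)
  ... | ∞     = yes (v-zero x vx)

  v-neg : ∀ x → v x ≤∞ v (- x)
  v-neg x = subst (v x ≤∞_) (sym v-x) (x≤∞y+∞x (v x) (v (- 1#)))
    where
    v-x : v (- x) ≡ v (- 1#) +∞ v x
    v-x = trans (v-cong (≈-sym (-1*x≈-x x))) (v-mult (- 1#) x)

  sumTo-closed : ∀ {s} (S : Carrier → Set s) → (∀ {x y} → S x → S y → S (x + y)) →
                 ∀ g k → (∀ {i} → i ≤ k → S (g i)) → S (sumTo g k)
  sumTo-closed S S-+ g zero    S-g = S-g z≤n
  sumTo-closed S S-+ g (suc k) S-g =
    S-+ (sumTo-closed S S-+ g k (λ i≤k → S-g (m≤n⇒m≤1+n i≤k))) (S-g ≤-refl)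

  sumTo-≈0 : ∀ g k → (∀ {i} → i ≤ k → g i ≈ 0#) → sumTo g k ≈ 0#
  sumTo-≈0 = sumTo-closed (_≈ 0#) (λ x≈0 y≈0 → ≈-trans (+-cong x≈0 y≈0) (+-identityʳ 0#))

  *-≈0 : ∀ {x y} → x ≈ 0# ⊎ y ≈ 0# → x * y ≈ 0#
  *-≈0 (inj₁ x≈0) = ≈-trans (*-congʳ x≈0) (zeroˡ _)
  *-≈0 (inj₂ y≈0) = ≈-trans (*-congˡ y≈0) (zeroʳ _)

  record Ultrametric (ν : Carrier → ℕ∞) : Set (c ⊔ ℓ) where
    field
      ν-cong : ∀ {x y} → x ≈ y → ν x ≡ ν y
      ν-neg  : ∀ x → ν x ≤∞ ν (- x)
      ν-add  : ∀ x y → min∞ (ν x) (ν y) ≤∞ ν (x + y)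

    ≤∞-+ : ∀ {z x y} → z ≤∞ ν x → z ≤∞ ν y → z ≤∞ ν (x + y)
    ≤∞-+ z≤x z≤y = ≤∞-trans (≤∞-min z≤x z≤y) (ν-add _ _)

    dominant-+ : ∀ {w x y} → ν x ≡ fin w → fin (suc w) ≤∞ ν y → ν (x + y) ≡ fin w
    dominant-+ {w} {x} {y} νx w<y = ≤∞∧≮⇒≡ (≤∞-+ (≤∞-reflexive (sym νx)) (≤∞-weaken w<y)) w≮x+y
      where
      -- otherwise x = (x + y) - y would have valuation above w
      w≮x+y : ¬ fin (suc w) ≤∞ ν (x + y)
      w≮x+y w<x+y = ≤∞-irrefl νx
        (subst (fin (suc w) ≤∞_) (ν-cong (//-rightDividesʳ y x)) (≤∞-+ w<x+y (≤∞-trans w<y (ν-neg y))))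

    sumTo-bounded : ∀ {z} g k → (∀ {i} → i ≤ k → z ≤∞ ν (g i)) → z ≤∞ ν (sumTo g k)
    sumTo-bounded = sumTo-closed (λ x → _ ≤∞ ν x) ≤∞-+

    sumTo-dominant : ∀ g k {i₀ w} → i₀ ≤ k → ν (g i₀) ≡ fin w →
                     (∀ {i} → i ≤ k → i ≢ i₀ → fin (suc w) ≤∞ ν (g i)) → ν (sumTo g k) ≡ fin w
    sumTo-dominant g zero    z≤n ν₀ _ = ν₀
    sumTo-dominant g (suc k) {i₀} i₀≤ ν₀ others with i₀ ≟ suc k
    ... | yes refl = trans (ν-cong (+-comm _ _)) (dominant-+ ν₀ (sumTo-bounded g k
                       (λ i≤k → others (m≤n⇒m≤1+n i≤k) (<⇒≢ (s≤s i≤k)))))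
    ... | no  i₀≢  = dominant-+ (sumTo-dominant g k (≤-pred (≤∧≢⇒< i₀≤ i₀≢)) ν₀
                       (λ i≤k → others (m≤n⇒m≤1+n i≤k))) (others ≤-refl (≢-sym i₀≢))

  v-ultrametric : Ultrametric v
  v-ultrametric = record { ν-cong = v-cong ; ν-neg = v-neg ; ν-add = v-add }

  zero⊎degree : ∀ {f} → FinSupp f → (∀ k → f k ≈ 0#) ⊎ ∃ (HasDegree f)
  zero⊎degree {f} (N , beyond) = search N beyond
    where
    search : ∀ N → (∀ k → N ℕ.< k → f k ≈ 0#) → (∀ k → f k ≈ 0#) ⊎ ∃ (HasDegree f)
    search N beyond with ≈0? (f N)
    ... | no  fN≉0 = inj₂ (N , fN≉0 , beyond)
    search zero    beyond | yes f0≈0 = inj₁ λ { zero → f0≈0 ; (suc k) → beyond (suc k) (s≤s z≤n) }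
    search (suc N) beyond | yes fN≈0 = search N λ k N<k → case m≤n⇒m<n∨m≡n N<k of λ
      { (inj₁ N+1<k) → beyond k N+1<k ; (inj₂ refl) → fN≈0 }

  degree-bound : ∀ {f d i} → HasDegree f d → ¬ f i ≈ 0# → i ≤ d
  degree-bound {i = i} (_ , beyond) fi≉0 = ≮⇒≥ (λ d<i → fi≉0 (beyond i d<i))

  HasDegree-unique : ∀ {f d d′} → HasDegree f d → HasDegree f d′ → d ≡ d′
  HasDegree-unique deg deg′ = ≤-antisym (degree-bound deg′ (proj₁ deg)) (degree-bound deg (proj₁ deg′))

  HasDegree-cong : ∀ {f g d} → f ≋ g → HasDegree f d → HasDegree g d
  HasDegree-cong f≋g (fd≉0 , beyond) =
    (λ gd≈0 → fd≉0 (≈-trans (f≋g _) gd≈0)) , λ k d<k → ≈-trans (≈-sym (f≋g k)) (beyond k d<k)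

  ⊛-term-zero : ∀ {f g d₁ d₂ k i} → HasDegree f d₁ → HasDegree g d₂ →
                d₁ ℕ.< i ⊎ d₂ ℕ.< k ∸ i → f i * g (k ∸ i) ≈ 0#
  ⊛-term-zero deg₁ deg₂ = *-≈0 ∘ Sum.map (proj₂ deg₁ _) (proj₂ deg₂ _)

  v-⊛-leading : ∀ {f g d₁ d₂} → HasDegree f d₁ → HasDegree g d₂ →
                v ((f ⊛ g) (d₁ ℕ.+ d₂)) ≡ v (f d₁) +∞ v (g d₂)
  v-⊛-leading {f} {g} {d₁} {d₂} deg₁ deg₂ with ≉0⇒v≡fin (proj₁ deg₁) | ≉0⇒v≡fin (proj₁ deg₂)
  ... | s , vf | t , vg = trans
    (Ultrametric.sumTo-dominant v-ultrametric _ (d₁ ℕ.+ d₂) (m≤m+n d₁ d₂) leading others)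
    (sym (cong₂ _+∞_ vf vg))
    where
    leading : v (f d₁ * g (d₁ ℕ.+ d₂ ∸ d₁)) ≡ fin (s ℕ.+ t)
    leading rewrite m+n∸m≡n d₁ d₂ | v-mult (f d₁) (g d₂) | vf | vg = refl
    others : ∀ {i} → i ≤ d₁ ℕ.+ d₂ → i ≢ d₁ → fin (suc (s ℕ.+ t)) ≤∞ v (f i * g (d₁ ℕ.+ d₂ ∸ i))
    others i≤ i≢d₁ = ≤∞-≡∞ (≈0⇒v≡∞ (⊛-term-zero deg₁ deg₂ (past-top ≤-refl (inj₁ i≢d₁))))

  degree-⊛ : ∀ {f g d₁ d₂} → HasDegree f d₁ → HasDegree g d₂ → HasDegree (f ⊛ g) (d₁ ℕ.+ d₂)
  degree-⊛ deg₁ deg₂ with ≉0⇒v≡fin (proj₁ deg₁) | ≉0⇒v≡fin (proj₁ deg₂)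
  ... | s , vf | t , vg =
    v≡fin⇒≉0 (trans (v-⊛-leading deg₁ deg₂) (cong₂ _+∞_ vf vg)) ,
    λ k top<k → sumTo-≈0 _ k (λ _ → ⊛-term-zero deg₁ deg₂ (past-top (<⇒≤ top<k) (inj₂ top<k)))

  factor-degrees : ∀ {f g k} → FinSupp f → FinSupp g → ¬ (f ⊛ g) k ≈ 0# →
                   ∃ (HasDegree f) × ∃ (HasDegree g)
  factor-degrees {k = k} fs gs fg≉0 with zero⊎degree fs | zero⊎degree gs
  ... | inj₂ deg-f | inj₂ deg-g = deg-f , deg-g
  ... | inj₁ f≈0   | _          = ⊥-elim (fg≉0 (sumTo-≈0 _ k λ _ → *-≈0 (inj₁ (f≈0 _))))
  ... | inj₂ _     | inj₁ g≈0   = ⊥-elim (fg≉0 (sumTo-≈0 _ k λ _ → *-≈0 (inj₂ (g≈0 _))))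

  degree-0-unit : ∀ {g d} → HasDegree g d → d ≡ 0 → v (g d) ≡ fin 0 → IsUnitPoly g
  degree-0-unit {g} (_ , beyond) refl vg₀ with valuationRing (g 0) 1# (subst (_≤∞ v 1#) (sym vg₀) (0≤∞ (v 1#)))
  ... | z , 1≈g₀z = const z , (0 , λ { (suc k) _ → ≈-refl }) , product
    where
    product : (g ⊛ const z) ≋ const 1#
    product zero    = ≈-sym 1≈g₀z
    product (suc k) = sumTo-≈0 _ (suc k) term
      where
      term : ∀ {i} → i ≤ suc k → g i * const z (suc k ∸ i) ≈ 0#
      term {zero}  _ = *-≈0 (inj₂ ≈-refl)
      term {suc i} _ = *-≈0 (inj₁ (beyond (suc i) (s≤s z≤n)))

  positive-degree⇒¬unit : ∀ {f n} → HasDegree f n → 0 ℕ.< n → ¬ IsUnitPoly f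
  positive-degree⇒¬unit {n = n} deg 0<n (q , fs-q , f⊛q≋1)
    with factor-degrees {k = 0} (n , proj₂ deg) fs-q (λ f⊛q≈0 → nontrivial (≈-trans (≈-sym (f⊛q≋1 0)) f⊛q≈0))
  ... | _ , (d , deg-q) = <⇒≢ 0<n (sym (m+n≡0⇒m≡0 n n+d≡0))
    where
    const-1-degree : HasDegree (const 1#) 0
    const-1-degree = nontrivial , λ { (suc k) _ → ≈-refl }
    n+d≡0 : n ℕ.+ d ≡ 0
    n+d≡0 = HasDegree-unique (HasDegree-cong f⊛q≋1 (degree-⊛ deg deg-q)) const-1-degree

  module Weighted (P m : ℕ) where
    open Weight P m

    vʷ : ℕ → Carrier → ℕ∞
    vʷ k x = weigh k (v x)

    ω : Poly → ℕ → ℕ∞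
    ω f k = vʷ k (f k)

    vʷ-ultrametric : ∀ k → Ultrametric (vʷ k)
    vʷ-ultrametric k = record
      { ν-cong = cong (weigh k) ∘ v-cong
      ; ν-neg  = λ x → weigh-mono (v-neg x)
      ; ν-add  = λ x y → subst (_≤∞ vʷ k (x + y)) (weigh-min k (v x) (v y)) (weigh-mono (v-add x y))
      }

    ω-term : ∀ f g {i k} → i ≤ k → vʷ k (f i * g (k ∸ i)) ≡ ω f i +∞ ω g (k ∸ i)
    ω-term _ _ i≤k = trans (cong (weigh _) (v-mult _ _)) (weigh-+∞ _ _ i≤k)

    ω-face : ∀ {f d} → HasDegree f d → ∃[ w ] ∃[ lo ] ∃[ hi ] Face (ω f) w lo hi
    ω-face (fd≉0 , beyond) with ≉0⇒v≡fin fd≉0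
    ... | _ , vfd = face (λ {i} d<i → cong (weigh i) (≈0⇒v≡∞ (beyond i d<i))) (cong (weigh _) vfd)

    face-width≤degree : ∀ {f d w lo hi} → Face (ω f) w lo hi → HasDegree f d → hi ∸ lo ≤ d
    face-width≤degree {lo = lo} {hi} F deg with weigh≡fin (Face.at-hi F)
    ... | _ , vf-hi , _ = ≤-trans (m∸n≤m hi lo) (degree-bound deg (v≡fin⇒≉0 vf-hi))

    ⊛-face : ∀ {f g w₁ lo₁ hi₁ w₂ lo₂ hi₂} → Face (ω f) w₁ lo₁ hi₁ → Face (ω g) w₂ lo₂ hi₂ →
             Face (ω (f ⊛ g)) (w₁ ℕ.+ w₂) (lo₁ ℕ.+ lo₂) (hi₁ ℕ.+ hi₂)
    ⊛-face {f} {g} {w₁} {lo₁} {hi₁} {w₂} {lo₂} {hi₂} F₁ F₂ = record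
      { at-lo   = U.sumTo-dominant _ _ (m≤m+n lo₁ lo₂)
                    (corner F₁.at-lo F₂.at-lo)
                    (λ i≤ i≢lo₁ → term-strict i≤ (Sum.map F₁.below F₂.below (past-bottom i≤ ≤-refl (inj₁ i≢lo₁))))
      ; at-hi   = U.sumTo-dominant _ _ (m≤m+n hi₁ hi₂)
                    (corner F₁.at-hi F₂.at-hi)
                    (λ i≤ i≢hi₁ → term-strict i≤ (Sum.map F₁.above F₂.above (past-top ≤-refl (inj₁ i≢hi₁))))
      ; minimal = λ k → U.sumTo-bounded _ k term-bound
      ; below   = λ {k} k<bottom → U.sumTo-bounded _ k (λ i≤k →
                    term-strict i≤k (Sum.map F₁.below F₂.below (past-bottom i≤k (<⇒≤ k<bottom) (inj₂ k<bottom))))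
      ; above   = λ {k} top<k → U.sumTo-bounded _ k (λ i≤k →
                    term-strict i≤k (Sum.map F₁.above F₂.above (past-top (<⇒≤ top<k) (inj₂ top<k))))
      }
      where
      module F₁ = Face F₁
      module F₂ = Face F₂
      module U {k} = Ultrametric (vʷ-ultrametric k)

      corner : ∀ {i₁ i₂} → ω f i₁ ≡ fin w₁ → ω g i₂ ≡ fin w₂ →
               vʷ (i₁ ℕ.+ i₂) (f i₁ * g (i₁ ℕ.+ i₂ ∸ i₁)) ≡ fin (w₁ ℕ.+ w₂)
      corner {i₁} {i₂} ωf ωg =
        trans (ω-term f g (m≤m+n i₁ i₂)) (cong₂ _+∞_ ωf (trans (cong (ω g) (m+n∸m≡n i₁ i₂)) ωg))

      term-bound : ∀ {k i} → i ≤ k → fin (w₁ ℕ.+ w₂) ≤∞ vʷ k (f i * g (k ∸ i))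
      term-bound i≤k = subst (_ ≤∞_) (sym (ω-term f g i≤k)) (+∞-mono-≤∞ (F₁.minimal _) (F₂.minimal _))

      term-strict : ∀ {k i} → i ≤ k → fin (suc w₁) ≤∞ ω f i ⊎ fin (suc w₂) ≤∞ ω g (k ∸ i) →
                    fin (suc (w₁ ℕ.+ w₂)) ≤∞ vʷ k (f i * g (k ∸ i))
      term-strict i≤k outside =
        subst (_ ≤∞_) (sym (ω-term f g i≤k)) (+∞-strict (F₁.minimal _) (F₂.minimal _) outside)

  long-factor : ∀ {a j l m} → l ℕ.< j → v (a j) ≡ fin 0 → v (a l) ≡ fin m →
                (∀ i → i ℕ.< j → i ≢ l → SlopeLess m j l i (v (a i))) → gcd m (j ∸ l) ≡ 1 →
                ∀ f₁ f₂ → FinSupp f₁ → FinSupp f₂ → a ≋ (f₁ ⊛ f₂) →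
                (∃ λ d → HasDegree f₁ d × j ∸ l ≤ d) ⊎ (∃ λ d → HasDegree f₂ d × j ∸ l ≤ d)
  long-factor {a} {j} {l} {m} l<j v-aj v-al slopes gcd≡1 f₁ f₂ fs₁ fs₂ a≋f₁f₂
    with factor-degrees {k = j} fs₁ fs₂ (λ f₁f₂≈0 → v≡fin⇒≉0 v-aj (≈-trans (a≋f₁f₂ j) f₁f₂≈0))
  ... | (d₁ , deg₁) , (d₂ , deg₂)
    with Weighted.ω-face (j ∸ l) m deg₁ | Weighted.ω-face (j ∸ l) m deg₂
  ... | w₁ , lo₁ , hi₁ , F₁ | w₂ , lo₂ , hi₂ , F₂ =
    Sum.map (λ long → d₁ , deg₁ , ≤-trans long (face-width≤degree F₁ deg₁))
            (λ long → d₂ , deg₂ , ≤-trans long (face-width≤degree F₂ deg₂))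
            (≤-+-∣ widths (face-width-divisible (Coprime.sym (gcd≡1⇒coprime gcd≡1)) F₁))
    where
    open Weight (j ∸ l) m using (weigh; face-width-divisible)
    open Weighted (j ∸ l) m using (ω; face-width≤degree; ⊛-face)

    slope-bound : ∀ {i} x → i ≤ j → SlopeLess m j l i x → fin (m ℕ.* j) ≤∞ weigh i x
    slope-bound (fin t) = weigh-slope m j l t
    slope-bound ∞       = λ _ _ → _ ≤∞∞

    ω-at-l : ω a l ≡ fin (m ℕ.* j)
    ω-at-l = trans (cong (weigh l) v-al) (weigh-vertexˡ m j l (<⇒≤ l<j))

    ω-at-j : ω a j ≡ fin (m ℕ.* j)
    ω-at-j = trans (cong (weigh j) v-aj) (weigh-vertexʳ m j l)

    ω-bound : ∀ i → fin (m ℕ.* j) ≤∞ ω a i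
    ω-bound i with i <? j
    ... | no  i≮j = weigh-beyond m j l (v (a i)) (≮⇒≥ i≮j)
    ... | yes i<j with i ≟ l
    ...   | yes refl = ≤∞-reflexive (sym ω-at-l)
    ...   | no  i≢l  = slope-bound (v (a i)) (<⇒≤ i<j) (slopes i i<j i≢l)

    ω≡ : ∀ i → ω a i ≡ ω (f₁ ⊛ f₂) i
    ω≡ i = cong (weigh i) (v-cong (a≋f₁f₂ i))

    within : ∀ {x} → ω a x ≡ fin (m ℕ.* j) → lo₁ ℕ.+ lo₂ ≤ x × x ≤ hi₁ ℕ.+ hi₂
    within ωx = Face.within (⊛-face F₁ F₂) (trans (sym (ω≡ _)) ωx) (λ i → subst (_ ≤∞_) (ω≡ i) (ω-bound i))

    widths : j ∸ l ≤ (hi₁ ∸ lo₁) ℕ.+ (hi₂ ∸ lo₂)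
    widths = width-bound (Face.lo≤hi F₁) (Face.lo≤hi F₂) (proj₁ (within ω-at-l)) (proj₂ (within ω-at-j))

  ⊛-leading : ∀ {a n f₁ f₂ d₁ d₂} → HasDegree a n → a ≋ (f₁ ⊛ f₂) → HasDegree f₁ d₁ → HasDegree f₂ d₂ →
              d₁ ℕ.+ d₂ ≡ n × v (f₁ d₁) +∞ v (f₂ d₂) ≡ v (a n)
  ⊛-leading {a} {n} {d₁ = d₁} {d₂} deg a≋f₁f₂ deg₁ deg₂ = d₁+d₂≡n ,
    trans (sym (v-⊛-leading deg₁ deg₂)) (trans (sym (v-cong (a≋f₁f₂ _))) (cong (v ∘ a) d₁+d₂≡n))
    where
    d₁+d₂≡n : d₁ ℕ.+ d₂ ≡ n
    d₁+d₂≡n = HasDegree-unique (HasDegree-cong (λ k → ≈-sym (a≋f₁f₂ k)) (degree-⊛ deg₁ deg₂)) deg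

  irreducible-of-long-factors :
    ∀ {a n} → HasDegree a n → v (a n) ≡ fin 0 → 0 ℕ.< n →
    (∀ f₁ f₂ → FinSupp f₁ → FinSupp f₂ → a ≋ (f₁ ⊛ f₂) →
       (∃ λ d → HasDegree f₁ d × n ≤ d) ⊎ (∃ λ d → HasDegree f₂ d × n ≤ d)) →
    Irreducible a
  irreducible-of-long-factors {a} {n} deg v-an 0<n long = positive-degree⇒¬unit deg 0<n , factors
    where
    factors : ∀ f₁ f₂ → FinSupp f₁ → FinSupp f₂ → a ≋ (f₁ ⊛ f₂) → IsUnitPoly f₁ ⊎ IsUnitPoly f₂
    factors f₁ f₂ fs₁ fs₂ a≋f₁f₂
      with factor-degrees {k = n} fs₁ fs₂ (λ f₁f₂≈0 → v≡fin⇒≉0 v-an (≈-trans (a≋f₁f₂ n) f₁f₂≈0))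
         | long f₁ f₂ fs₁ fs₂ a≋f₁f₂
    ... | _ , (_ , deg₂) | inj₁ (d₁ , deg₁ , n≤d₁) with ⊛-leading deg a≋f₁f₂ deg₁ deg₂
    ...   | d₁+d₂≡n , v-lead = inj₂ (degree-0-unit deg₂
            (m+n≤m⇒n≡0 d₁ (subst (_≤ d₁) (sym d₁+d₂≡n) n≤d₁)) (proj₂ (+∞≡0 _ _ (trans v-lead v-an))))
    factors f₁ f₂ fs₁ fs₂ a≋f₁f₂
        | (_ , deg₁) , _ | inj₂ (d₂ , deg₂ , n≤d₂) with ⊛-leading deg a≋f₁f₂ deg₁ deg₂
    ...   | d₁+d₂≡n , v-lead = inj₁ (degree-0-unit deg₁
            (m+n≤n⇒m≡0 d₂ (subst (_≤ d₂) (sym d₁+d₂≡n) n≤d₂)) (proj₁ (+∞≡0 _ _ (trans v-lead v-an))))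

theorem1 : ∀ {c ℓ : Level} (D : DVD c ℓ) → let open DVD D in let open Poly D in
    (a : Poly) (n : ℕ) → (∀ k → n < k → a k ≈ 0#) → Primitive a n →
    (j l : ℕ) → suc l ≤ j → j ≤ n →
    v (a j) ≡ fin 0 →
    (m : ℕ) → v (a l) ≡ fin m →
    (∀ i → i < j → ¬ (i ≡ l) → SlopeLess m j l i (v (a i))) →
    gcd m (j ∸ l) ≡ 1 →
    (∀ f₁ f₂ → FinSupp f₁ → FinSupp f₂ → a ≋ (f₁ ⊛ f₂) →
       (∃ λ d → HasDegree f₁ d × j ∸ l ≤ d) ⊎ (∃ λ d → HasDegree f₂ d × j ∸ l ≤ d))
    × (j ≡ n → l ≡ 0 → Irreducible a)
theorem1 D a n beyond-n _ j l l<j _ v-aj m v-al slopes gcd≡1 =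
  long-factor l<j v-aj v-al slopes gcd≡1 ,
  λ { refl refl → irreducible-of-long-factors (v≡fin⇒≉0 v-aj , beyond-n) v-aj l<j
                    (long-factor l<j v-aj v-al slopes gcd≡1) }
  where open Valuation D
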